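{- If $\mathsf{Kt}2\vdash A$ then $\mathsf{IKt}2\vdash A^N$.
   Context: Formulas: $A ::= P \mid X \mid A\to B \mid \Box A \mid \blacksquare A \mid \forall X A$, with $\bot := \forall XX$, $\neg A := A\to\bot$, $\Diamond A := \forall X(\Box(A\to\blacksquare X)\to X)$, backward diamond $\Diamond^{\bullet}A := \forall X(\blacksquare(A\to\Box X)\to X)$. $\mathsf{IKt}2$: second-order intuitionistic propositional logic (with full comprehension $\forall XA\to A[C/X]$, modus ponens, generalisation with fresh propositional symbol), distribution axioms $\Box(A\to B)\to\Box A\to\Box B$, $\Box(A\to B)\to\Diamond A\to\Diamond B$, $\blacksquare(A\to B)\to\blacksquare A\to\blacksquare B$, $\blacksquare(A\to B)\to\Diamond^{\bullet}A\to\Diamond^{\bullet}B$, necessitation for $\Box$ and $\blacksquare$, tense axioms $\Diamond^{\bullet}\Box A\to A$, $A\to\Box\Diamond^{\bullet}A$, $\Diamond\blacksquare A\to A$, $A\to\blacksquare\Diamond A$; $\mathsf{Kt}2 := \mathsf{IKt}2+(\neg\neg A\to A)$. The negative (Gödel–Gentzen) translation: $P^N := \neg\neg P$, $X^N := \neg\neg X$, $(A\to B)^N := A^N\to B^N$, $(\Box A)^N := \Box A^N$, $(\blacksquare A)^N := \blacksquare A^N$, $(\forall XA)^N := \forall X A^N$. -}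

module Defs where

open import Data.Nat using (ℕ; zero; suc)
open import Data.Fin using (Fin; zero; suc)
open import Data.Bool using (Bool; true; false)
open import Relation.Nullary using (¬_)

-- Formulas of second-order tense logic.  Form n: formulas with at most n
-- free propositional variables X (de Bruijn indices); propositional symbols
-- P are 'atom p' with p : ℕ.
infixr 5 _⇒_
data Form (n : ℕ) : Set where
  atom : ℕ → Form n
  var  : Fin n → Form n
  _⇒_  : Form n → Form n → Form n
  □    : Form n → Form n
  ■    : Form n → Form n
  ∀'   : Form (suc n) → Form n

ext : ∀ {n m} → (Fin n → Fin m) → Fin (suc n) → Fin (suc m)
ext ρ zero    = zero
ext ρ (suc i) = suc (ρ i)

rename : ∀ {n m} → (Fin n → Fin m) → Form n → Form m
rename ρ (atom p) = atom p
rename ρ (var i)  = var (ρ i)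
rename ρ (A ⇒ B)  = rename ρ A ⇒ rename ρ B
rename ρ (□ A)    = □ (rename ρ A)
rename ρ (■ A)    = ■ (rename ρ A)
rename ρ (∀' A)   = ∀' (rename (ext ρ) A)

wk : ∀ {n} → Form n → Form (suc n)
wk = rename suc

exts : ∀ {n m} → (Fin n → Form m) → Fin (suc n) → Form (suc m)
exts σ zero    = var zero
exts σ (suc i) = wk (σ i)

subst : ∀ {n m} → (Fin n → Form m) → Form n → Form m
subst σ (atom p) = atom p
subst σ (var i)  = σ i
subst σ (A ⇒ B)  = subst σ A ⇒ subst σ B
subst σ (□ A)    = □ (subst σ A)
subst σ (■ A)    = ■ (subst σ A)
subst σ (∀' A)   = ∀' (subst (exts σ) A)

_[_] : ∀ {n} → Form (suc n) → Form n → Form n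
A [ C ] = subst σ A
  where
  σ : Fin _ → Form _
  σ zero    = C
  σ (suc i) = var i

data _occursIn_ (p : ℕ) {n : ℕ} : Form n → Set where
  here : p occursIn atom p
  ⇒ˡ   : ∀ {A B} → p occursIn A → p occursIn (A ⇒ B)
  ⇒ʳ   : ∀ {A B} → p occursIn B → p occursIn (A ⇒ B)
  □ᵒ   : ∀ {A} → p occursIn A → p occursIn □ A
  ■ᵒ   : ∀ {A} → p occursIn A → p occursIn ■ A
  ∀ᵒ   : ∀ {A} → p occursIn A → p occursIn ∀' A

⊥' : ∀ {n} → Form n
⊥' = ∀' (var zero)

¬' : ∀ {n} → Form n → Form n
¬' A = A ⇒ ⊥'

◇ : ∀ {n} → Form n → Form n
◇ A = ∀' (□ (wk A ⇒ ■ (var zero)) ⇒ var zero)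

◆ : ∀ {n} → Form n → Form n
◆ A = ∀' (■ (wk A ⇒ □ (var zero)) ⇒ var zero)

-- Hilbert system; the Bool flag says whether the classical axiom
-- ¬¬A → A is available (false = IKt2, true = Kt2).
-- Theorems are closed formulas (Form 0).
data _⊢_ : Bool → Form 0 → Set where
  ax-K    : ∀ {classical} {A B} → classical ⊢ (A ⇒ B ⇒ A)
  ax-S    : ∀ {classical} {A B C} → classical ⊢ ((A ⇒ B ⇒ C) ⇒ (A ⇒ B) ⇒ A ⇒ C)
  ax-inst : ∀ {classical} (A : Form 1) (C : Form 0) → classical ⊢ (∀' A ⇒ A [ C ])
  mp      : ∀ {classical} {A B} → classical ⊢ (A ⇒ B) → classical ⊢ A → classical ⊢ B
  gen     : ∀ {classical} {A : Form 0} {B : Form 1} (p : ℕ) →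
            ¬ (p occursIn A) → ¬ (p occursIn B) →
            classical ⊢ (A ⇒ B [ atom p ]) → classical ⊢ (A ⇒ ∀' B)
  ax-□K   : ∀ {classical} {A B} → classical ⊢ (□ (A ⇒ B) ⇒ □ A ⇒ □ B)
  ax-□◇   : ∀ {classical} {A B} → classical ⊢ (□ (A ⇒ B) ⇒ ◇ A ⇒ ◇ B)
  ax-■K   : ∀ {classical} {A B} → classical ⊢ (■ (A ⇒ B) ⇒ ■ A ⇒ ■ B)
  ax-■◆   : ∀ {classical} {A B} → classical ⊢ (■ (A ⇒ B) ⇒ ◆ A ⇒ ◆ B)
  nec-□   : ∀ {classical} {A} → classical ⊢ A → classical ⊢ □ A
  nec-■   : ∀ {classical} {A} → classical ⊢ A → classical ⊢ ■ A
  ax-t1   : ∀ {classical} {A} → classical ⊢ (◆ (□ A) ⇒ A)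
  ax-t2   : ∀ {classical} {A} → classical ⊢ (A ⇒ □ (◆ A))
  ax-t3   : ∀ {classical} {A} → classical ⊢ (◇ (■ A) ⇒ A)
  ax-t4   : ∀ {classical} {A} → classical ⊢ (A ⇒ ■ (◇ A))
  ax-dne  : ∀ {A} → true ⊢ (¬' (¬' A) ⇒ A)

IKt2⊢_ : Form 0 → Set
IKt2⊢ A = false ⊢ A

Kt2⊢_ : Form 0 → Set
Kt2⊢ A = true ⊢ A

_ᴺ : ∀ {n} → Form n → Form n
atom p ᴺ = ¬' (¬' (atom p))
var i ᴺ  = ¬' (¬' (var i))
(A ⇒ B) ᴺ = A ᴺ ⇒ B ᴺ
□ A ᴺ    = □ (A ᴺ)
■ A ᴺ    = ■ (A ᴺ)
∀' A ᴺ   = ∀' (A ᴺ)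

-- The heart of the proof is that every
-- translated formula Aᴺ is ¬¬-stable in IKt2.  For ∀ and → this is as in
-- the propositional case; for □ and ■ it uses the tense adjunctions ◇ ⊣ ■
-- and ◆ ⊣ □, which let ¬¬ be pushed through a box.  Stability validates the
-- translated double-negation axiom, and it gives ¬¬Cᴺ ↔ Cᴺ, so the
-- comprehension instance (A[C/X])ᴺ follows from Aᴺ[Cᴺ/X].  A translated
-- diamond is not the diamond of the translation (its bound variable X
-- becomes ¬¬X), but both are equivalent to ¬¬◇, which settles the
-- remaining tense axioms.
module Submission where

open import Defs
open import Data.Bool using (Bool; false)
open import Data.Fin using (Fin; zero; suc)
open import Data.List using (List; []; _∷_)
open import Data.List.Membership.Propositional using (_∈_)
open import Data.List.Relation.Unary.Any using (here; there)
open import Data.Nat using (ℕ; suc; _⊔_; _<_; _≤_)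
open import Data.Nat.Properties using (m≤m⊔n; m≤n⊔m; <-≤-trans; <-irrefl; n<1+n)
open import Data.Product using (_×_; _,_; proj₁; proj₂)
open import Data.Vec.Functional using () renaming (_∷_ to _∷ₛ_)
open import Function using (_∘_)
open import Relation.Nullary using (¬_)
open import Relation.Binary.PropositionalEquality using (_≡_; refl; sym; trans; cong; cong₂)
import Relation.Binary.PropositionalEquality as ≡

private
  variable
    n m k : ℕ

ext-cong : {ρ ρ′ : Fin n → Fin m} → (∀ i → ρ i ≡ ρ′ i) → ∀ i → ext ρ i ≡ ext ρ′ i
ext-cong h zero    = refl
ext-cong h (suc i) = cong suc (h i)

ext-∘ : (ρ : Fin m → Fin k) (ρ′ : Fin n → Fin m) → ∀ i → ext ρ (ext ρ′ i) ≡ ext (ρ ∘ ρ′) i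
ext-∘ ρ ρ′ zero    = refl
ext-∘ ρ ρ′ (suc i) = refl

rename-cong : {ρ ρ′ : Fin n → Fin m} → (∀ i → ρ i ≡ ρ′ i) → ∀ A → rename ρ A ≡ rename ρ′ A
rename-cong h (atom p) = refl
rename-cong h (var i)  = cong var (h i)
rename-cong h (A ⇒ B)  = cong₂ _⇒_ (rename-cong h A) (rename-cong h B)
rename-cong h (□ A)    = cong □ (rename-cong h A)
rename-cong h (■ A)    = cong ■ (rename-cong h A)
rename-cong h (∀' A)   = cong ∀' (rename-cong (ext-cong h) A)

rename-∘ : (ρ : Fin m → Fin k) (ρ′ : Fin n → Fin m) →
           ∀ A → rename ρ (rename ρ′ A) ≡ rename (ρ ∘ ρ′) A
rename-∘ ρ ρ′ (atom p) = refl
rename-∘ ρ ρ′ (var i)  = refl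
rename-∘ ρ ρ′ (A ⇒ B)  = cong₂ _⇒_ (rename-∘ ρ ρ′ A) (rename-∘ ρ ρ′ B)
rename-∘ ρ ρ′ (□ A)    = cong □ (rename-∘ ρ ρ′ A)
rename-∘ ρ ρ′ (■ A)    = cong ■ (rename-∘ ρ ρ′ A)
rename-∘ ρ ρ′ (∀' A)   =
  cong ∀' (trans (rename-∘ (ext ρ) (ext ρ′) A) (rename-cong (ext-∘ ρ ρ′) A))

exts-cong : {σ τ : Fin n → Form m} → (∀ i → σ i ≡ τ i) → ∀ i → exts σ i ≡ exts τ i
exts-cong h zero    = refl
exts-cong h (suc i) = cong wk (h i)

subst-cong : {σ τ : Fin n → Form m} → (∀ i → σ i ≡ τ i) → ∀ A → subst σ A ≡ subst τ A
subst-cong h (atom p) = refl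
subst-cong h (var i)  = h i
subst-cong h (A ⇒ B)  = cong₂ _⇒_ (subst-cong h A) (subst-cong h B)
subst-cong h (□ A)    = cong □ (subst-cong h A)
subst-cong h (■ A)    = cong ■ (subst-cong h A)
subst-cong h (∀' A)   = cong ∀' (subst-cong (exts-cong h) A)

exts-var : ∀ (i : Fin (suc n)) → exts var i ≡ var i
exts-var zero    = refl
exts-var (suc i) = refl

subst-id : (A : Form n) → subst var A ≡ A
subst-id (atom p) = refl
subst-id (var i)  = refl
subst-id (A ⇒ B)  = cong₂ _⇒_ (subst-id A) (subst-id B)
subst-id (□ A)    = cong □ (subst-id A)
subst-id (■ A)    = cong ■ (subst-id A)
subst-id (∀' A)   = cong ∀' (trans (subst-cong exts-var A) (subst-id A))

exts-ext : (σ : Fin m → Form k) (ρ : Fin n → Fin m) → ∀ i → exts σ (ext ρ i) ≡ exts (σ ∘ ρ) i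
exts-ext σ ρ zero    = refl
exts-ext σ ρ (suc i) = refl

subst-rename : (σ : Fin m → Form k) (ρ : Fin n → Fin m) →
               ∀ A → subst σ (rename ρ A) ≡ subst (σ ∘ ρ) A
subst-rename σ ρ (atom p) = refl
subst-rename σ ρ (var i)  = refl
subst-rename σ ρ (A ⇒ B)  = cong₂ _⇒_ (subst-rename σ ρ A) (subst-rename σ ρ B)
subst-rename σ ρ (□ A)    = cong □ (subst-rename σ ρ A)
subst-rename σ ρ (■ A)    = cong ■ (subst-rename σ ρ A)
subst-rename σ ρ (∀' A)   =
  cong ∀' (trans (subst-rename (exts σ) (ext ρ) A) (subst-cong (exts-ext σ ρ) A))

rename-exts : (ρ : Fin m → Fin k) (σ : Fin n → Form m) →
              ∀ i → rename (ext ρ) (exts σ i) ≡ exts (rename ρ ∘ σ) i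
rename-exts ρ σ zero    = refl
rename-exts ρ σ (suc i) = trans (rename-∘ (ext ρ) suc (σ i)) (sym (rename-∘ suc ρ (σ i)))

rename-subst : (ρ : Fin m → Fin k) (σ : Fin n → Form m) →
               ∀ A → rename ρ (subst σ A) ≡ subst (rename ρ ∘ σ) A
rename-subst ρ σ (atom p) = refl
rename-subst ρ σ (var i)  = refl
rename-subst ρ σ (A ⇒ B)  = cong₂ _⇒_ (rename-subst ρ σ A) (rename-subst ρ σ B)
rename-subst ρ σ (□ A)    = cong □ (rename-subst ρ σ A)
rename-subst ρ σ (■ A)    = cong ■ (rename-subst ρ σ A)
rename-subst ρ σ (∀' A)   =
  cong ∀' (trans (rename-subst (ext ρ) (exts σ) A) (subst-cong (rename-exts ρ σ) A))

subst-exts : (τ : Fin m → Form k) (σ : Fin n → Form m) →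
             ∀ i → subst (exts τ) (exts σ i) ≡ exts (subst τ ∘ σ) i
subst-exts τ σ zero    = refl
subst-exts τ σ (suc i) = trans (subst-rename (exts τ) suc (σ i)) (sym (rename-subst suc τ (σ i)))

subst-subst : (τ : Fin m → Form k) (σ : Fin n → Form m) →
              ∀ A → subst τ (subst σ A) ≡ subst (subst τ ∘ σ) A
subst-subst τ σ (atom p) = refl
subst-subst τ σ (var i)  = refl
subst-subst τ σ (A ⇒ B)  = cong₂ _⇒_ (subst-subst τ σ A) (subst-subst τ σ B)
subst-subst τ σ (□ A)    = cong □ (subst-subst τ σ A)
subst-subst τ σ (■ A)    = cong ■ (subst-subst τ σ A)
subst-subst τ σ (∀' A)   =
  cong ∀' (trans (subst-subst (exts τ) (exts σ) A) (subst-cong (subst-exts τ σ) A))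

[]-as-subst : (B : Form (suc n)) (C : Form n) → B [ C ] ≡ subst (C ∷ₛ var) B
[]-as-subst B C = subst-cong single B
  where
  single : ∀ i → _
  single zero    = refl
  single (suc i) = refl

wk-[] : (C D : Form n) → wk C [ D ] ≡ C
wk-[] C D = trans ([]-as-subst (wk C) D) (trans (subst-rename (D ∷ₛ var) suc C) (subst-id C))

exts-[] : (σ : Fin n → Form 0) (B : Form (suc n)) (C : Form 0) →
          subst (exts σ) B [ C ] ≡ subst (C ∷ₛ σ) B
exts-[] σ B C =
  trans ([]-as-subst (subst (exts σ) B) C)
        (trans (subst-subst (C ∷ₛ var) (exts σ) B) (subst-cong instantiate B))
  where
  instantiate : ∀ i → subst (C ∷ₛ var) (exts σ i) ≡ (C ∷ₛ σ) i
  instantiate zero    = refl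
  instantiate (suc i) = trans (subst-rename (C ∷ₛ var) suc (σ i)) (subst-id (σ i))

rename-ᴺ : (ρ : Fin n → Fin m) (A : Form n) → rename ρ (A ᴺ) ≡ rename ρ A ᴺ
rename-ᴺ ρ (atom p) = refl
rename-ᴺ ρ (var i)  = refl
rename-ᴺ ρ (A ⇒ B)  = cong₂ _⇒_ (rename-ᴺ ρ A) (rename-ᴺ ρ B)
rename-ᴺ ρ (□ A)    = cong □ (rename-ᴺ ρ A)
rename-ᴺ ρ (■ A)    = cong ■ (rename-ᴺ ρ A)
rename-ᴺ ρ (∀' A)   = cong ∀' (rename-ᴺ (ext ρ) A)

Atomicᴺ : (Fin n → Form m) → Set
Atomicᴺ σ = ∀ i → σ i ᴺ ≡ ¬' (¬' (σ i))

exts-Atomicᴺ : (σ : Fin n → Form m) → Atomicᴺ σ → Atomicᴺ (exts σ)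
exts-Atomicᴺ σ h zero    = refl
exts-Atomicᴺ σ h (suc i) = trans (sym (rename-ᴺ suc (σ i))) (cong wk (h i))

subst-ᴺ : (σ : Fin n → Form m) → Atomicᴺ σ → ∀ A → subst σ (A ᴺ) ≡ subst σ A ᴺ
subst-ᴺ σ h (atom p) = refl
subst-ᴺ σ h (var i)  = sym (h i)
subst-ᴺ σ h (A ⇒ B)  = cong₂ _⇒_ (subst-ᴺ σ h A) (subst-ᴺ σ h B)
subst-ᴺ σ h (□ A)    = cong □ (subst-ᴺ σ h A)
subst-ᴺ σ h (■ A)    = cong ■ (subst-ᴺ σ h A)
subst-ᴺ σ h (∀' A)   = cong ∀' (subst-ᴺ (exts σ) (exts-Atomicᴺ σ h) A)

[atom]-ᴺ : (B : Form (suc n)) (p : ℕ) → (B [ atom p ]) ᴺ ≡ B ᴺ [ atom p ]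
[atom]-ᴺ B p =
  trans (cong _ᴺ ([]-as-subst B (atom p)))
        (trans (sym (subst-ᴺ (atom p ∷ₛ var) atomic B)) (sym ([]-as-subst (B ᴺ) (atom p))))
  where
  atomic : Atomicᴺ (atom p ∷ₛ var)
  atomic zero    = refl
  atomic (suc i) = refl

occursIn-ᴺ : ∀ {p} (A : Form n) → p occursIn (A ᴺ) → p occursIn A
occursIn-ᴺ (atom q) (⇒ˡ (⇒ˡ here))      = here
occursIn-ᴺ (atom q) (⇒ˡ (⇒ʳ (∀ᵒ ())))
occursIn-ᴺ (atom q) (⇒ʳ (∀ᵒ ()))
occursIn-ᴺ (var i)  (⇒ˡ (⇒ˡ ()))
occursIn-ᴺ (var i)  (⇒ˡ (⇒ʳ (∀ᵒ ())))
occursIn-ᴺ (var i)  (⇒ʳ (∀ᵒ ()))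
occursIn-ᴺ (A ⇒ B)  (⇒ˡ o)              = ⇒ˡ (occursIn-ᴺ A o)
occursIn-ᴺ (A ⇒ B)  (⇒ʳ o)              = ⇒ʳ (occursIn-ᴺ B o)
occursIn-ᴺ (□ A)    (□ᵒ o)              = □ᵒ (occursIn-ᴺ A o)
occursIn-ᴺ (■ A)    (■ᵒ o)              = ■ᵒ (occursIn-ᴺ A o)
occursIn-ᴺ (∀' A)   (∀ᵒ o)              = ∀ᵒ (occursIn-ᴺ A o)

atomBound : Form n → ℕ
atomBound (atom p) = suc p
atomBound (var i)  = 0
atomBound (A ⇒ B)  = atomBound A ⊔ atomBound B
atomBound (□ A)    = atomBound A
atomBound (■ A)    = atomBound A
atomBound (∀' A)   = atomBound A

occursIn⇒<atomBound : ∀ {p} {A : Form n} → p occursIn A → p < atomBound A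
occursIn⇒<atomBound {p = p} here = n<1+n p
occursIn⇒<atomBound {A = A ⇒ B} (⇒ˡ o) =
  <-≤-trans (occursIn⇒<atomBound o) (m≤m⊔n (atomBound A) (atomBound B))
occursIn⇒<atomBound {A = A ⇒ B} (⇒ʳ o) =
  <-≤-trans (occursIn⇒<atomBound o) (m≤n⊔m (atomBound A) (atomBound B))
occursIn⇒<atomBound (□ᵒ o) = occursIn⇒<atomBound o
occursIn⇒<atomBound (■ᵒ o) = occursIn⇒<atomBound o
occursIn⇒<atomBound (∀ᵒ o) = occursIn⇒<atomBound o

atomBound≤⇒¬occursIn : ∀ {p} {A : Form n} → atomBound A ≤ p → ¬ (p occursIn A)
atomBound≤⇒¬occursIn le o = <-irrefl refl (<-≤-trans (occursIn⇒<atomBound o) le)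

data Tense : Set where
  future past : Tense

opposite : Tense → Tense
opposite future = past
opposite past   = future

□⟨_⟩ : Tense → Form n → Form n
□⟨ future ⟩ = □
□⟨ past ⟩   = ■

-- ◇[ t , F ] A = ∀X (□⟨t⟩(A → □⟨opposite t⟩ F) → F).  With F = X this is ◇
-- (t = future) or ◆ (t = past); with F = ¬¬X it is their translation.
◇[_,_] : Tense → Form (suc n) → Form n → Form n
◇[ t , F ] A = ∀' (□⟨ t ⟩ (wk A ⇒ □⟨ opposite t ⟩ F) ⇒ F)

◇⟨_⟩ ◇ᴺ⟨_⟩ : Tense → Form n → Form n
◇⟨ t ⟩  = ◇[ t , var zero ]
◇ᴺ⟨ t ⟩ = ◇[ t , ¬' (¬' (var zero)) ]

□⟨⟩-ᴺ : ∀ t (A : Form n) → □⟨ t ⟩ A ᴺ ≡ □⟨ t ⟩ (A ᴺ)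
□⟨⟩-ᴺ future A = refl
□⟨⟩-ᴺ past   A = refl

◇⟨⟩-ᴺ : ∀ t (A : Form n) → ◇⟨ t ⟩ A ᴺ ≡ ◇ᴺ⟨ t ⟩ (A ᴺ)
◇⟨⟩-ᴺ t A =
  cong (λ B → ∀' (B ⇒ ¬' (¬' (var zero))))
       (trans (□⟨⟩-ᴺ t _)
              (cong □⟨ t ⟩ (cong₂ _⇒_ (sym (rename-ᴺ suc A)) (□⟨⟩-ᴺ (opposite t) _))))

◇[]-body-[] : ∀ t (F : Form (suc n)) (A D : Form n) →
  (□⟨ t ⟩ (wk A ⇒ □⟨ opposite t ⟩ F) ⇒ F) [ D ] ≡ □⟨ t ⟩ (A ⇒ □⟨ opposite t ⟩ (F [ D ])) ⇒ F [ D ]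
◇[]-body-[] future F A D = cong (λ B → □ (B ⇒ ■ (F [ D ])) ⇒ F [ D ]) (wk-[] A D)
◇[]-body-[] past   F A D = cong (λ B → ■ (B ⇒ □ (F [ D ])) ⇒ F [ D ]) (wk-[] A D)

-- The head of Γ (the hypothesis #0 below) is the last premise of Γ ⇛ A.
_⇛_ : List (Form 0) → Form 0 → Form 0
[]      ⇛ A = A
(B ∷ Γ) ⇛ A = Γ ⇛ (B ⇒ A)

module _ {c : Bool} where

  infix 2 ⊢_ ⊢_⇔_

  ⊢_ : Form 0 → Set
  ⊢ A = c ⊢ A

  ⊢_⇔_ : Form 0 → Form 0 → Set
  ⊢ A ⇔ B = (⊢ A ⇒ B) × (⊢ B ⇒ A)

  Stable : Form 0 → Set
  Stable A = ⊢ ¬' (¬' A) ⇒ A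

  private
    variable
      A A′ B B′ C D : Form 0
      Γ : List (Form 0)

  cast : A ≡ B → ⊢ A → ⊢ B
  cast = ≡.subst (λ A → ⊢ A)

  generalise : {B : Form 1} → (∀ p → ⊢ A ⇒ B [ atom p ]) → ⊢ A ⇒ ∀' B
  generalise {A} {B} h =
    gen p (atomBound≤⇒¬occursIn (m≤m⊔n _ _)) (atomBound≤⇒¬occursIn (m≤n⊔m _ _)) (h p)
    where p = atomBound A ⊔ atomBound B

  ⇒-refl : ⊢ A ⇒ A
  ⇒-refl {A} = mp (mp ax-S (ax-K {B = A ⇒ A})) ax-K

  infixl 6 _·_
  infix 5 ƛ_

  data ND (Γ : List (Form 0)) : Form 0 → Set where
    hyp : A ∈ Γ → ND Γ A
    ƛ_  : ND (A ∷ Γ) B → ND Γ (A ⇒ B)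
    _·_ : ND Γ (A ⇒ B) → ND Γ A → ND Γ B
    thm : ⊢ A → ND Γ A

  #0 : ND (A ∷ Γ) A
  #0 = hyp (here refl)

  #1 : ND (B ∷ A ∷ Γ) A
  #1 = hyp (there (here refl))

  #2 : ND (C ∷ B ∷ A ∷ Γ) A
  #2 = hyp (there (there (here refl)))

  #3 : ND (D ∷ C ∷ B ∷ A ∷ Γ) A
  #3 = hyp (there (there (there (here refl))))

  ⇛-const : ∀ Γ → ⊢ A → ⊢ Γ ⇛ A
  ⇛-const []      d = d
  ⇛-const (B ∷ Γ) d = ⇛-const Γ (mp ax-K d)

  ⇛-mp : ∀ Γ → ⊢ Γ ⇛ (A ⇒ B) → ⊢ Γ ⇛ A → ⊢ Γ ⇛ B
  ⇛-mp []      f x = mp f x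
  ⇛-mp (C ∷ Γ) f x = ⇛-mp Γ (⇛-mp Γ (⇛-const Γ ax-S) f) x

  ⇛-hyp : ∀ Γ → A ∈ Γ → ⊢ Γ ⇛ A
  ⇛-hyp (A ∷ Γ) (here refl) = ⇛-const Γ ⇒-refl
  ⇛-hyp (B ∷ Γ) (there h)   = ⇛-mp Γ (⇛-const Γ ax-K) (⇛-hyp Γ h)

  nd-sound : ND Γ A → ⊢ Γ ⇛ A
  nd-sound {Γ} (hyp h) = ⇛-hyp Γ h
  nd-sound     (ƛ t)   = nd-sound t
  nd-sound {Γ} (t · u) = ⇛-mp Γ (nd-sound t) (nd-sound u)
  nd-sound {Γ} (thm d) = ⇛-const Γ d

  derive : ND [] A → ⊢ A
  derive = nd-sound

  ⇒-trans : ⊢ A ⇒ B → ⊢ B ⇒ C → ⊢ A ⇒ C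
  ⇒-trans f g = derive (ƛ thm g · (thm f · #0))

  ⇒-map : ⊢ A′ ⇒ A → ⊢ B ⇒ B′ → ⊢ (A ⇒ B) ⇒ (A′ ⇒ B′)
  ⇒-map f g = derive (ƛ ƛ thm g · (#1 · (thm f · #0)))

  ¬¬-intro : ⊢ A ⇒ ¬' (¬' A)
  ¬¬-intro = derive (ƛ ƛ #0 · #1)

  ¬¬-map : ⊢ A ⇒ B → ⊢ ¬' (¬' A) ⇒ ¬' (¬' B)
  ¬¬-map f = derive (ƛ ƛ #1 · (ƛ #1 · (thm f · #0)))

  ⊥'-elim : ⊢ ⊥' ⇒ A
  ⊥'-elim {A} = ax-inst (var zero) A

  ⇔-refl : ⊢ A ⇔ A
  ⇔-refl = ⇒-refl , ⇒-refl

  ⇔-⇒ : ⊢ A ⇔ A′ → ⊢ B ⇔ B′ → ⊢ (A ⇒ B) ⇔ (A′ ⇒ B′)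
  ⇔-⇒ (f , f′) (g , g′) = ⇒-map f′ g , ⇒-map f g′

  ⇔-∀' : {B B′ : Form 1} → (∀ p → ⊢ B [ atom p ] ⇔ B′ [ atom p ]) → ⊢ ∀' B ⇔ ∀' B′
  ⇔-∀' h = generalise (λ p → ⇒-trans (ax-inst _ (atom p)) (proj₁ (h p))) ,
           generalise (λ p → ⇒-trans (ax-inst _ (atom p)) (proj₂ (h p)))

  stable-¬¬ : Stable (¬' (¬' A))
  stable-¬¬ = derive (ƛ ƛ #1 · (ƛ #0 · #1))

  stable-⇒ : Stable B → Stable (A ⇒ B)
  stable-⇒ s = derive (ƛ ƛ thm s · (ƛ #2 · (ƛ #1 · (#0 · #2))))

  stable-∀' : {B : Form 1} → (∀ p → Stable (B [ atom p ])) → Stable (∀' B)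
  stable-∀' s = generalise (λ p → ⇒-trans (¬¬-map (ax-inst _ (atom p))) (s p))

  □⟨⟩-K : ∀ t → ⊢ □⟨ t ⟩ (A ⇒ B) ⇒ □⟨ t ⟩ A ⇒ □⟨ t ⟩ B
  □⟨⟩-K future = ax-□K
  □⟨⟩-K past   = ax-■K

  □⟨⟩-nec : ∀ t → ⊢ A → ⊢ □⟨ t ⟩ A
  □⟨⟩-nec future = nec-□
  □⟨⟩-nec past   = nec-■

  ◇⟨⟩-K : ∀ t → ⊢ □⟨ t ⟩ (A ⇒ B) ⇒ ◇⟨ t ⟩ A ⇒ ◇⟨ t ⟩ B
  ◇⟨⟩-K future = ax-□◇
  ◇⟨⟩-K past   = ax-■◆

  unit : ∀ t → ⊢ A ⇒ □⟨ opposite t ⟩ (◇⟨ t ⟩ A)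
  unit future = ax-t4
  unit past   = ax-t2

  -- unit at the opposite tense; needed separately since opposite (opposite t)
  -- does not reduce to t
  unit˘ : ∀ t → ⊢ A ⇒ □⟨ t ⟩ (◇⟨ opposite t ⟩ A)
  unit˘ future = ax-t2
  unit˘ past   = ax-t4

  counit : ∀ t → ⊢ ◇⟨ t ⟩ (□⟨ opposite t ⟩ A) ⇒ A
  counit future = ax-t3
  counit past   = ax-t1

  □⟨⟩-map : ∀ t → ⊢ A ⇒ B → ⊢ □⟨ t ⟩ A ⇒ □⟨ t ⟩ B
  □⟨⟩-map t f = mp (□⟨⟩-K t) (□⟨⟩-nec t f)

  ⇔-□⟨⟩ : ∀ t → ⊢ A ⇔ B → ⊢ □⟨ t ⟩ A ⇔ □⟨ t ⟩ B
  ⇔-□⟨⟩ t (f , g) = □⟨⟩-map t f , □⟨⟩-map t g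

  ◇[]-elim : ∀ t (F : Form 1) A D →
    ⊢ ◇[ t , F ] A ⇒ □⟨ t ⟩ (A ⇒ □⟨ opposite t ⟩ (F [ D ])) ⇒ F [ D ]
  ◇[]-elim t F A D = cast (cong (◇[ t , F ] A ⇒_) (◇[]-body-[] t F A D)) (ax-inst _ D)

  ◇[]-intro : ∀ t (F : Form 1) →
    (∀ p → ⊢ B ⇒ □⟨ t ⟩ (A ⇒ □⟨ opposite t ⟩ (F [ atom p ])) ⇒ F [ atom p ]) → ⊢ B ⇒ ◇[ t , F ] A
  ◇[]-intro {B} {A} t F h =
    generalise (λ p → cast (cong (B ⇒_) (sym (◇[]-body-[] t F A (atom p)))) (h p))

  ◇⟨⟩-⊥ : ∀ t → ⊢ ◇⟨ t ⟩ ⊥' ⇒ ⊥'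
  ◇⟨⟩-⊥ t = derive (ƛ thm (◇[]-elim t (var zero) ⊥' ⊥') · #0 · thm (□⟨⟩-nec t ⊥'-elim))

  □-◇¬-inconsistent : ∀ t → ⊢ □⟨ t ⟩ A ⇒ ◇⟨ t ⟩ (¬' A) ⇒ ⊥'
  □-◇¬-inconsistent t =
    derive (ƛ ƛ thm (◇⟨⟩-⊥ t) · (thm (◇⟨⟩-K t) · (thm (□⟨⟩-map t ¬¬-intro) · #1) · #0))

  ¬◇⇒□¬ : ∀ t → ⊢ ¬' (◇⟨ t ⟩ A) ⇒ □⟨ t ⟩ (¬' A)
  ¬◇⇒□¬ t = ⇒-trans (unit˘ t) (□⟨⟩-map t refute)
    where
    refute : ⊢ ◇⟨ opposite t ⟩ (¬' (◇⟨ t ⟩ A)) ⇒ ¬' A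
    refute = derive (ƛ ƛ thm (□-◇¬-inconsistent (opposite t)) · (thm (unit t) · #0) · #1)

  ◇¬¬⇒¬¬◇ : ∀ t → ⊢ ◇⟨ t ⟩ (¬' (¬' A)) ⇒ ¬' (¬' (◇⟨ t ⟩ A))
  ◇¬¬⇒¬¬◇ t = derive (ƛ ƛ thm (□-◇¬-inconsistent t) · (thm (¬◇⇒□¬ t) · #0) · #1)

  stable-□⟨opposite⟩ : ∀ t → Stable A → Stable (□⟨ opposite t ⟩ A)
  stable-□⟨opposite⟩ t s =
    ⇒-trans (unit t) (□⟨⟩-map (opposite t) (⇒-trans (◇¬¬⇒¬¬◇ t) (⇒-trans (¬¬-map (counit t)) s)))

  ◇⇒◇ᴺ : ∀ t → ⊢ ◇⟨ t ⟩ A ⇒ ◇ᴺ⟨ t ⟩ A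
  ◇⇒◇ᴺ t = ◇[]-intro t _ (λ p → ◇[]-elim t (var zero) _ (¬' (¬' (atom p))))

  ◇ᴺ⇒¬¬◇ : ∀ t → ⊢ ◇ᴺ⟨ t ⟩ A ⇒ ¬' (¬' (◇⟨ t ⟩ A))
  ◇ᴺ⇒¬¬◇ {A} t =
    derive (ƛ thm (◇[]-elim t _ A (◇⟨ t ⟩ A)) · #0
                · thm (□⟨⟩-nec t (⇒-trans (unit t) (□⟨⟩-map (opposite t) ¬¬-intro))))

  ¬¬◇⇒◇ᴺ : ∀ t → ⊢ ¬' (¬' (◇⟨ t ⟩ A)) ⇒ ◇ᴺ⟨ t ⟩ A
  ¬¬◇⇒◇ᴺ t = ◇[]-intro t _ (λ p →
    derive (ƛ ƛ ƛ #2 · (ƛ thm (◇[]-elim t (var zero) _ _) · #0 · #2 · #1)))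

  ◇ᴺ-K : ∀ t → ⊢ □⟨ t ⟩ (A ⇒ B) ⇒ ◇ᴺ⟨ t ⟩ A ⇒ ◇ᴺ⟨ t ⟩ B
  ◇ᴺ-K t =
    derive (ƛ ƛ thm (¬¬◇⇒◇ᴺ t) · (ƛ thm (◇ᴺ⇒¬¬◇ t) · #1 · (ƛ #1 · (thm (◇⟨⟩-K t) · #3 · #0))))

  stable-subst-ᴺ : (A : Form n) (σ : Fin n → Form 0) → Stable (subst σ (A ᴺ))
  stable-subst-ᴺ (atom p) σ = stable-¬¬
  stable-subst-ᴺ (var i)  σ = stable-¬¬
  stable-subst-ᴺ (A ⇒ B)  σ = stable-⇒ (stable-subst-ᴺ B σ)
  stable-subst-ᴺ (□ A)    σ = stable-□⟨opposite⟩ past (stable-subst-ᴺ A σ)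
  stable-subst-ᴺ (■ A)    σ = stable-□⟨opposite⟩ future (stable-subst-ᴺ A σ)
  stable-subst-ᴺ (∀' B)   σ = stable-∀' (λ p →
    ≡.subst Stable (sym (exts-[] σ (B ᴺ) (atom p))) (stable-subst-ᴺ B (atom p ∷ₛ σ)))

  stable-ᴺ : ∀ A → Stable (A ᴺ)
  stable-ᴺ A = ≡.subst Stable (subst-id (A ᴺ)) (stable-subst-ᴺ A var)

  subst-ᴺ-⇔ : (A : Form n) (σ′ σ : Fin n → Form 0) →
    (∀ i → ⊢ ¬' (¬' (σ′ i)) ⇔ σ i ᴺ) → ⊢ subst σ′ (A ᴺ) ⇔ subst σ A ᴺ
  subst-ᴺ-⇔ (atom p) σ′ σ h = ⇔-refl
  subst-ᴺ-⇔ (var i)  σ′ σ h = h i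
  subst-ᴺ-⇔ (A ⇒ B)  σ′ σ h = ⇔-⇒ (subst-ᴺ-⇔ A σ′ σ h) (subst-ᴺ-⇔ B σ′ σ h)
  subst-ᴺ-⇔ (□ A)    σ′ σ h = ⇔-□⟨⟩ future (subst-ᴺ-⇔ A σ′ σ h)
  subst-ᴺ-⇔ (■ A)    σ′ σ h = ⇔-□⟨⟩ past (subst-ᴺ-⇔ A σ′ σ h)
  subst-ᴺ-⇔ (∀' B)   σ′ σ h = ⇔-∀' (λ p →
    ≡.subst₂ (λ X Y → ⊢ X ⇔ Y) (sym (exts-[] σ′ (B ᴺ) (atom p))) (instantiated p)
      (subst-ᴺ-⇔ B (atom p ∷ₛ σ′) (atom p ∷ₛ σ) (extended p)))
    where
    instantiated : ∀ p → subst (atom p ∷ₛ σ) B ᴺ ≡ subst (exts σ) B ᴺ [ atom p ]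
    instantiated p = trans (cong _ᴺ (sym (exts-[] σ B (atom p)))) ([atom]-ᴺ (subst (exts σ) B) p)
    extended : ∀ p i → ⊢ ¬' (¬' ((atom p ∷ₛ σ′) i)) ⇔ (atom p ∷ₛ σ) i ᴺ
    extended p zero    = ⇔-refl
    extended p (suc i) = h i

  inst-ᴺ : (A : Form 1) (C : Form 0) → ⊢ (∀' A ⇒ A [ C ]) ᴺ
  inst-ᴺ A C =
    ⇒-trans (ax-inst (A ᴺ) (C ᴺ))
      (cast (cong₂ _⇒_ (sym ([]-as-subst (A ᴺ) (C ᴺ))) (cong _ᴺ (sym ([]-as-subst A C))))
        (proj₁ (subst-ᴺ-⇔ A (C ᴺ ∷ₛ var) (C ∷ₛ var) translated)))
    where
    translated : ∀ i → ⊢ ¬' (¬' ((C ᴺ ∷ₛ var) i)) ⇔ (C ∷ₛ var) i ᴺ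
    translated zero = stable-ᴺ C , ¬¬-intro

  ⊥'ᴺ⇔⊥' : ⊢ ⊥' ᴺ ⇔ ⊥'
  ⊥'ᴺ⇔⊥' = ⇒-trans (ax-inst _ ⊥') (derive (ƛ #0 · (ƛ #0))) , ⊥'-elim

  dne-ᴺ : ∀ A → ⊢ (¬' (¬' A) ⇒ A) ᴺ
  dne-ᴺ A = ⇒-trans (proj₁ (⇔-⇒ (⇔-⇒ ⇔-refl ⊥'ᴺ⇔⊥') ⊥'ᴺ⇔⊥')) (stable-ᴺ A)

  ◇⟨⟩-K-ᴺ : ∀ t → ⊢ (□⟨ t ⟩ (A ⇒ B) ⇒ ◇⟨ t ⟩ A ⇒ ◇⟨ t ⟩ B) ᴺ
  ◇⟨⟩-K-ᴺ {A} {B} t =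
    cast (sym (cong₂ _⇒_ (□⟨⟩-ᴺ t (A ⇒ B)) (cong₂ _⇒_ (◇⟨⟩-ᴺ t A) (◇⟨⟩-ᴺ t B)))) (◇ᴺ-K t)

  unit-ᴺ : ∀ t → ⊢ (A ⇒ □⟨ opposite t ⟩ (◇⟨ t ⟩ A)) ᴺ
  unit-ᴺ {A} t =
    cast (sym (cong (A ᴺ ⇒_) (trans (□⟨⟩-ᴺ (opposite t) _) (cong □⟨ opposite t ⟩ (◇⟨⟩-ᴺ t A)))))
      (⇒-trans (unit t) (□⟨⟩-map (opposite t) (◇⇒◇ᴺ t)))

  counit-ᴺ : ∀ t → ⊢ (◇⟨ t ⟩ (□⟨ opposite t ⟩ A) ⇒ A) ᴺ
  counit-ᴺ {A} t =
    cast (sym (cong (_⇒ A ᴺ) (trans (◇⟨⟩-ᴺ t _) (cong ◇ᴺ⟨ t ⟩ (□⟨⟩-ᴺ (opposite t) A)))))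
      (⇒-trans (◇ᴺ⇒¬¬◇ t) (⇒-trans (¬¬-map (counit t)) (stable-ᴺ A)))

translate : ∀ {c A} → c ⊢ A → false ⊢ (A ᴺ)
translate ax-K                 = ax-K
translate ax-S                 = ax-S
translate (ax-inst A C)        = inst-ᴺ A C
translate (mp d e)             = mp (translate d) (translate e)
translate (gen {A = A} {B = B} p p∉A p∉B d) =
  gen p (p∉A ∘ occursIn-ᴺ A) (p∉B ∘ occursIn-ᴺ B)
    (cast (cong (A ᴺ ⇒_) ([atom]-ᴺ B p)) (translate d))
translate ax-□K                = ax-□K
translate (ax-□◇ {A = A} {B})  = ◇⟨⟩-K-ᴺ {A = A} {B} future
translate ax-■K                = ax-■K
translate (ax-■◆ {A = A} {B})  = ◇⟨⟩-K-ᴺ {A = A} {B} past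
translate (nec-□ d)            = nec-□ (translate d)
translate (nec-■ d)            = nec-■ (translate d)
translate (ax-t1 {A = A})      = counit-ᴺ {A = A} past
translate (ax-t2 {A = A})      = unit-ᴺ {A = A} past
translate (ax-t3 {A = A})      = counit-ᴺ {A = A} future
translate (ax-t4 {A = A})      = unit-ᴺ {A = A} future
translate (ax-dne {A = A})     = dne-ᴺ A

theorem8p2 : ∀ (A : Form 0) → Kt2⊢ A → IKt2⊢ (A ᴺ)
theorem8p2 A = translate
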